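{- Let $n\ge 1$ and $v,w\in S_n$. If the pair $(v,w)$ is well-aligned, then $v\le_B w$ in Bruhat order.
   Context: Permutations are written in one-line notation $w=w(1)\cdots w(n)$; $\le_B$ denotes (strong) Bruhat order on $S_n$. For $w\in S_n$, $\delta(w)\in S_{n-1}$ is obtained from the one-line notation of $w$ by deleting the entry $1$ and decrementing all remaining entries by $1$ (e.g. $\delta(25143)=1432$). A pair $(v,w)\in S_n\times S_n$ is aligned if (1) $v^{ -1}(1)\le w^{ -1}(1)$, and (2) every index $i$ with $v^{ -1}(1)\le i\le w^{ -1}(1)-1$ is an ascent of $v$, i.e. $v(i)<v(i+1)$. The pair is well-aligned if it is aligned and $(\delta(v),\delta(w))$ is well-aligned (recursively; the unique pair in $S_1\times S_1$ is well-aligned). -}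

module Defs where

open import Data.Nat using (ℕ; zero; suc)
open import Data.Fin using (Fin; toℕ; _<_; _≤_) renaming (zero to fzero)
open import Data.Fin.Permutation using (Permutation′; _⟨$⟩ʳ_; _⟨$⟩ˡ_; _∘ₚ_; transpose; remove; _≈_)
open import Data.Product using (Σ; _×_; ∃; ∃-syntax)
open import Data.Unit using (⊤)
open import Relation.Binary.PropositionalEquality using (_≡_)

-- S_n is modelled as Permutation′ n (bijections Fin n ↔ Fin n); positions and
-- values are 0-based, so the paper's entry 1 is fzero.
-- One-line notation: w(i) = w ⟨$⟩ʳ i, and w⁻¹(a) = w ⟨$⟩ˡ a.

-- δ(w): delete the entry 1 (i.e. fzero) from the one-line notation and
-- decrement the remaining entries.  This is exactly stdlib's `remove`
-- applied at the position w⁻¹(1).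
δ : ∀ {n} → Permutation′ (suc n) → Permutation′ n
δ w = remove (w ⟨$⟩ˡ fzero) w

-- A covering-type step u → u·t_{ij}: for positions i < j with
-- u(i) < u(j), swap the entries in positions i and j (this increases length).
BruhatStep : ∀ {n} → Permutation′ n → Permutation′ n → Set
BruhatStep {n} u w =
  ∃[ i ] ∃[ j ] (i < j × (u ⟨$⟩ʳ i) < (u ⟨$⟩ʳ j) × w ≈ (transpose i j ∘ₚ u))

data _≤B_ {n : ℕ} : Permutation′ n → Permutation′ n → Set where
  ≤B-refl : ∀ {u w} → u ≈ w → u ≤B w
  ≤B-step : ∀ {u v w} → BruhatStep u v → v ≤B w → u ≤B w

infix 4 _≤B_

Aligned : ∀ {n} → Permutation′ (suc n) → Permutation′ (suc n) → Set
Aligned {n} v w =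
  ((v ⟨$⟩ˡ fzero) ≤ (w ⟨$⟩ˡ fzero)) ×
  ((i j : Fin (suc n)) → (v ⟨$⟩ˡ fzero) ≤ i → i < (w ⟨$⟩ˡ fzero) →
     toℕ j ≡ suc (toℕ i) → (v ⟨$⟩ʳ i) < (v ⟨$⟩ʳ j))

-- The base case S_0 is ⊤; for S_1 this gives
-- Aligned v w × ⊤, and Aligned holds trivially in S_1, matching the paper's
-- base case "the unique pair in S_1 × S_1 is well-aligned".
WellAligned : ∀ {n} → Permutation′ n → Permutation′ n → Set
WellAligned {zero}  v w = ⊤
WellAligned {suc n} v w = Aligned v w × WellAligned (δ v) (δ w)

-- Let p and q be the positions of the entry 1 in v and w, so that v and w are
-- δ(v) and δ(w) with an entry 1 inserted at positions p and q.  Moving the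
-- inserted 1 one place to the right swaps it with a larger entry, a Bruhat
-- step up; as p ≤ q, inserting at p is therefore below inserting at q.
-- Inserting an entry at a fixed position maps Bruhat steps to Bruhat steps,
-- so the induction hypothesis δ(v) ≤ δ(w) survives insertion at q.  Only
-- condition (1) of alignment is used.
module Submission where

open import Defs
open import Data.Nat using (ℕ; zero; suc; s≤s; z≤n)
open import Data.Fin using (Fin; punchIn; punchOut; inject₁; _<_; _≤_)
  renaming (zero to fzero; suc to fsuc)
open import Data.Fin.Properties
  using (_≟_; ≤-refl; punchIn-injective; punchInᵢ≢i; punchIn-punchOut; ≤̄⇒inject₁<)
open import Data.Fin.Induction using (<-weakInduction-startingFrom)
open import Data.Fin.Permutation
  using (Permutation; Permutation′; _⟨$⟩ʳ_; _⟨$⟩ˡ_; _≈_; insert; insert-punchIn;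
         insert-remove; inverseʳ; lift₀-transpose)
import Data.Fin.Permutation.Components as PC
open import Data.Product using (_,_)
open import Function using (_∘_; _∘′_)
open import Function.Definitions using (Injective)
open import Relation.Nullary using (yes; no)
open import Relation.Nullary.Negation using (contradiction)
open import Relation.Binary.PropositionalEquality
  using (_≡_; _≢_; refl; sym; trans; cong; subst; subst₂; module ≡-Reasoning)

private
  variable
    n : ℕ

≗-by-punchIn : ∀ {A : Set} (q : Fin (suc n)) {f g : Fin (suc n) → A} →
               f q ≡ g q → (∀ m → f (punchIn q m) ≡ g (punchIn q m)) →
               ∀ k → f k ≡ g k
≗-by-punchIn q {f} {g} fq≡gq f≡g k with q ≟ k
... | yes refl = fq≡gq
... | no q≢k = subst (λ x → f x ≡ g x) (punchIn-punchOut q≢k) (f≡g (punchOut q≢k))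

punchIn-mono-< : ∀ (i : Fin (suc n)) {j k : Fin n} → j < k → punchIn i j < punchIn i k
punchIn-mono-< fzero    j<k                         = s≤s j<k
punchIn-mono-< (fsuc _) {fzero}  {fsuc _} _         = s≤s z≤n
punchIn-mono-< (fsuc i) {fsuc _} {fsuc _} (s≤s j<k) = s≤s (punchIn-mono-< i j<k)

transpose-≢ : ∀ {i j k : Fin n} → k ≢ i → k ≢ j → PC.transpose i j k ≡ k
transpose-≢ {i = i} {j} {k} k≢i k≢j with k ≟ i
... | yes k≡i = contradiction k≡i k≢i
... | no _ with k ≟ j
...   | yes k≡j = contradiction k≡j k≢j
...   | no _ = refl

transpose-matchʳ : ∀ (i j : Fin n) → PC.transpose i j j ≡ i
transpose-matchʳ i j with j ≟ i
... | yes j≡i = j≡i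
... | no _ with j ≟ j
...   | yes _ = refl
...   | no j≢j = contradiction refl j≢j

injective⇒transpose-commute : ∀ {m} {f : Fin m → Fin n} → Injective _≡_ _≡_ f →
  ∀ i j k → PC.transpose (f i) (f j) (f k) ≡ f (PC.transpose i j k)
injective⇒transpose-commute {f = f} f-inj i j k with k ≟ i | f k ≟ f i
... | yes _   | yes _    = refl
... | yes k≡i | no fk≢fi = contradiction (cong f k≡i) fk≢fi
... | no k≢i  | yes fk≡fi = contradiction (f-inj fk≡fi) k≢i
... | no _    | no _ with k ≟ j | f k ≟ f j
...   | yes _   | yes _    = refl
...   | yes k≡j | no fk≢fj = contradiction (cong f k≡j) fk≢fj
...   | no k≢j  | yes fk≡fj = contradiction (f-inj fk≡fj) k≢j
...   | no _    | no _     = refl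

transpose-adjacent-punchIn : ∀ (i : Fin n) m →
  PC.transpose (inject₁ i) (fsuc i) (punchIn (fsuc i) m) ≡ punchIn (inject₁ i) m
transpose-adjacent-punchIn fzero    fzero    = refl
transpose-adjacent-punchIn fzero    (fsuc m) = refl
transpose-adjacent-punchIn (fsuc i) fzero    = refl
transpose-adjacent-punchIn (fsuc i) (fsuc m) =
  trans (lift₀-transpose (inject₁ i) (fsuc i) (fsuc (punchIn (fsuc i) m)))
        (cong fsuc (transpose-adjacent-punchIn i m))

insert-at : ∀ {m} (i : Fin (suc m)) (j : Fin (suc n)) (π : Permutation m n) →
            insert i j π ⟨$⟩ʳ i ≡ j
insert-at i j π with i ≟ i
... | yes _ = refl
... | no i≢i = contradiction refl i≢i

insert-δ : (v : Permutation′ (suc n)) → insert (v ⟨$⟩ˡ fzero) fzero (δ v) ≈ v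
insert-δ v k = begin
  insert p fzero (δ v) ⟨$⟩ʳ k      ≡⟨ cong (λ z → insert p z (δ v) ⟨$⟩ʳ k) (sym (inverseʳ v)) ⟩
  insert p (v ⟨$⟩ʳ p) (δ v) ⟨$⟩ʳ k ≡⟨ insert-remove p v k ⟩
  v ⟨$⟩ʳ k                        ∎
  where
  open ≡-Reasoning
  p = v ⟨$⟩ˡ fzero

insert-cong : ∀ {m} (i : Fin (suc m)) (j : Fin (suc n)) {π ρ : Permutation m n} →
              π ≈ ρ → insert i j π ≈ insert i j ρ
insert-cong i j {π} {ρ} π≈ρ = ≗-by-punchIn i
  (trans (insert-at i j π) (sym (insert-at i j ρ)))
  (λ m → begin
    insert i j π ⟨$⟩ʳ punchIn i m ≡⟨ insert-punchIn i j π m ⟩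
    punchIn j (π ⟨$⟩ʳ m)          ≡⟨ cong (punchIn j) (π≈ρ m) ⟩
    punchIn j (ρ ⟨$⟩ʳ m)          ≡⟨ insert-punchIn i j ρ m ⟨
    insert i j ρ ⟨$⟩ʳ punchIn i m ∎)
  where open ≡-Reasoning

≤B-respˡ-≈ : ∀ {u v w : Permutation′ n} → u ≈ v → v ≤B w → u ≤B w
≤B-respˡ-≈ u≈v (≤B-refl v≈w) = ≤B-refl (λ k → trans (u≈v k) (v≈w k))
≤B-respˡ-≈ u≈v (≤B-step (i , j , i<j , vi<vj , x≈tv) x≤w) =
  ≤B-step (i , j , i<j , subst₂ _<_ (sym (u≈v i)) (sym (u≈v j)) vi<vj ,
           λ k → trans (x≈tv k) (sym (u≈v (PC.transpose i j k))))
          x≤w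

≤B-trans : ∀ {u v w : Permutation′ n} → u ≤B v → v ≤B w → u ≤B w
≤B-trans (≤B-refl u≈v)   v≤w = ≤B-respˡ-≈ u≈v v≤w
≤B-trans (≤B-step s x≤v) v≤w = ≤B-step s (≤B-trans x≤v v≤w)

BruhatStep-insert : ∀ (q z : Fin (suc n)) {a b : Permutation′ n} →
                    BruhatStep a b → BruhatStep (insert q z a) (insert q z b)
BruhatStep-insert q z {a} {b} (i , j , i<j , ai<aj , b≈ta) =
  punchIn q i , punchIn q j , punchIn-mono-< q i<j ,
  subst₂ _<_ (sym (insert-punchIn q z a i)) (sym (insert-punchIn q z a j))
         (punchIn-mono-< z ai<aj) ,
  ≗-by-punchIn q at-q at-punchIn
  where
  open ≡-Reasoning
  t = PC.transpose (punchIn q i) (punchIn q j)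

  at-q : insert q z b ⟨$⟩ʳ q ≡ insert q z a ⟨$⟩ʳ t q
  at-q = begin
    insert q z b ⟨$⟩ʳ q   ≡⟨ insert-at q z b ⟩
    z                     ≡⟨ insert-at q z a ⟨
    insert q z a ⟨$⟩ʳ q   ≡⟨ cong (insert q z a ⟨$⟩ʳ_)
                               (transpose-≢ (punchInᵢ≢i q i ∘′ sym) (punchInᵢ≢i q j ∘′ sym)) ⟨
    insert q z a ⟨$⟩ʳ t q ∎

  at-punchIn : ∀ m → insert q z b ⟨$⟩ʳ punchIn q m ≡ insert q z a ⟨$⟩ʳ t (punchIn q m)
  at-punchIn m = begin
    insert q z b ⟨$⟩ʳ punchIn q m                    ≡⟨ insert-punchIn q z b m ⟩
    punchIn z (b ⟨$⟩ʳ m)                             ≡⟨ cong (punchIn z) (b≈ta m) ⟩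
    punchIn z (a ⟨$⟩ʳ PC.transpose i j m)            ≡⟨ insert-punchIn q z a _ ⟨
    insert q z a ⟨$⟩ʳ punchIn q (PC.transpose i j m) ≡⟨ cong (insert q z a ⟨$⟩ʳ_)
      (injective⇒transpose-commute (punchIn-injective q _ _) i j m) ⟨
    insert q z a ⟨$⟩ʳ t (punchIn q m)                ∎

insert-mono-≤B : ∀ (q z : Fin (suc n)) {a b : Permutation′ n} →
                 a ≤B b → insert q z a ≤B insert q z b
insert-mono-≤B q z (≤B-refl a≈b) = ≤B-refl (insert-cong q z a≈b)
insert-mono-≤B q z (≤B-step s x≤b) = ≤B-step (BruhatStep-insert q z s) (insert-mono-≤B q z x≤b)

punchIn-inject₁ : ∀ (i : Fin n) → punchIn (inject₁ i) i ≡ fsuc i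
punchIn-inject₁ fzero    = refl
punchIn-inject₁ (fsuc i) = cong fsuc (punchIn-inject₁ i)

BruhatStep-insert-zero-suc : ∀ (a : Permutation′ n) (i : Fin n) →
  BruhatStep (insert (inject₁ i) fzero a) (insert (fsuc i) fzero a)
BruhatStep-insert-zero-suc a i =
  inject₁ i , fsuc i , ≤̄⇒inject₁< ≤-refl ,
  subst₂ _<_ (sym (insert-at p fzero a)) (sym value-at-suc) (s≤s z≤n) ,
  ≗-by-punchIn (fsuc i) at-suc at-punchIn
  where
  open ≡-Reasoning
  p = inject₁ i
  t = PC.transpose p (fsuc i)

  value-at-suc : insert p fzero a ⟨$⟩ʳ fsuc i ≡ fsuc (a ⟨$⟩ʳ i)
  value-at-suc = begin
    insert p fzero a ⟨$⟩ʳ fsuc i      ≡⟨ cong (insert p fzero a ⟨$⟩ʳ_) (punchIn-inject₁ i) ⟨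
    insert p fzero a ⟨$⟩ʳ punchIn p i ≡⟨ insert-punchIn p fzero a i ⟩
    fsuc (a ⟨$⟩ʳ i)                   ∎

  at-suc : insert (fsuc i) fzero a ⟨$⟩ʳ fsuc i ≡ insert p fzero a ⟨$⟩ʳ t (fsuc i)
  at-suc = begin
    insert (fsuc i) fzero a ⟨$⟩ʳ fsuc i ≡⟨ insert-at (fsuc i) fzero a ⟩
    fzero                              ≡⟨ insert-at p fzero a ⟨
    insert p fzero a ⟨$⟩ʳ p            ≡⟨ cong (insert p fzero a ⟨$⟩ʳ_) (transpose-matchʳ p (fsuc i)) ⟨
    insert p fzero a ⟨$⟩ʳ t (fsuc i)   ∎

  at-punchIn : ∀ m → insert (fsuc i) fzero a ⟨$⟩ʳ punchIn (fsuc i) m ≡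
                     insert p fzero a ⟨$⟩ʳ t (punchIn (fsuc i) m)
  at-punchIn m = begin
    insert (fsuc i) fzero a ⟨$⟩ʳ punchIn (fsuc i) m ≡⟨ insert-punchIn (fsuc i) fzero a m ⟩
    fsuc (a ⟨$⟩ʳ m)                                 ≡⟨ insert-punchIn p fzero a m ⟨
    insert p fzero a ⟨$⟩ʳ punchIn p m               ≡⟨ cong (insert p fzero a ⟨$⟩ʳ_)
                                                         (transpose-adjacent-punchIn i m) ⟨
    insert p fzero a ⟨$⟩ʳ t (punchIn (fsuc i) m)    ∎

insert-zero-mono-≤B : ∀ (a : Permutation′ n) {p q : Fin (suc n)} →
                      p ≤ q → insert p fzero a ≤B insert q fzero a
insert-zero-mono-≤B a {p} =
  <-weakInduction-startingFrom (λ q → insert p fzero a ≤B insert q fzero a)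
    (≤B-refl λ _ → refl)
    (λ i p≤i → ≤B-trans p≤i (≤B-step {v = insert (fsuc i) fzero a}
                                (BruhatStep-insert-zero-suc a i) (≤B-refl λ _ → refl)))

wellAligned⇒≤B : ∀ {n} (v w : Permutation′ n) → WellAligned v w → v ≤B w
wellAligned⇒≤B {zero}  v w _ = ≤B-refl λ ()
wellAligned⇒≤B {suc n} v w ((p≤q , _) , δ-wellAligned) =
  ≤B-respˡ-≈ (sym ∘ insert-δ v) (
  ≤B-trans (insert-zero-mono-≤B (δ v) p≤q) (
  ≤B-trans (insert-mono-≤B (w ⟨$⟩ˡ fzero) fzero (wellAligned⇒≤B (δ v) (δ w) δ-wellAligned))
           (≤B-refl (insert-δ w))))

lemma3p4 : (n : ℕ) → (v w : Permutation′ (suc n)) → WellAligned v w → v ≤B w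
lemma3p4 n = wellAligned⇒≤B
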